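{- Let $G$ be a finite simple graph with $n$ vertices. If $\alpha(G)>n/2$, then $|core(G)|>|N(core(G))|$.
   Context: $\alpha(G)$ is the maximum size of a stable set of $G$; $\Omega(G)$ is the set of maximum stable sets; $core(G)=\bigcap\{S:S\in\Omega(G)\}$; for $A\subseteq V(G)$, $N(A)$ is the set of all vertices adjacent to at least one vertex of $A$. -}

module Defs where

open import Data.Bool using (Bool; true; false; _∧_; not; if_then_else_)
open import Data.Nat using (ℕ; zero; suc; _⊔_; _≡ᵇ_)
open import Data.Fin using (Fin)
open import Data.List using (List; []; _∷_; [_]; map; _++_; foldr; allFin)
open import Data.Bool.ListAction using (all; any)
import Data.List as List
open import Data.Vec using (Vec; lookup; tabulate)
import Data.Vec as Vec
open import Data.Fin.Subset using (Subset; ∣_∣)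
open import Relation.Binary.PropositionalEquality using (_≡_)

record Graph (n : ℕ) : Set where
  field
    adj      : Fin n → Fin n → Bool
    adj-sym  : ∀ u v → adj u v ≡ adj v u
    adj-irr  : ∀ v → adj v v ≡ false
open Graph public

allSubsets : (n : ℕ) → List (Subset n)
allSubsets zero    = [ Vec.[] ]
allSubsets (suc n) = map (true Vec.∷_) (allSubsets n) ++ map (false Vec.∷_) (allSubsets n)

isStable : ∀ {n} → Graph n → Subset n → Bool
isStable {n} G S =
  all (λ u → all (λ v → not (lookup S u ∧ lookup S v ∧ adj G u v)) (allFin n)) (allFin n)

stableSets : ∀ {n} → Graph n → List (Subset n)
stableSets {n} G = List.filterᵇ (isStable G) (allSubsets n)

α : ∀ {n} → Graph n → ℕ
α G = foldr _⊔_ 0 (map ∣_∣ (stableSets G))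

Ω : ∀ {n} → Graph n → List (Subset n)
Ω G = List.filterᵇ (λ S → ∣ S ∣ ≡ᵇ α G) (stableSets G)

core : ∀ {n} → Graph n → Subset n
core G = tabulate (λ v → all (λ S → lookup S v) (Ω G))

N : ∀ {n} → Graph n → Subset n → Subset n
N {n} G A = tabulate (λ v → any (λ u → lookup A u ∧ adj G u v) (allFin n))

{-# OPTIONS --safe #-}
module Submission where

-- If S is a maximum stable set and Z a stable set disjoint from S, then Z ∪ (S ∖ N(Z)) is
-- stable, hence |Z| ≤ |S ∩ N(Z)|. For a stable X this gives |N(X ∩ S)| < |X ∩ S| whenever
-- |N(X)| < |X|: apply it to Z = X ∖ S and note that N(X ∩ S) and S ∩ N(X ∖ S) are disjoint
-- (S is stable) parts of N(X). A maximum stable set S has |N(S)| ≤ n − |S| < |S| once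
-- α(G) > n/2, and intersecting S with all maximum stable sets in turn yields core(G).

open import Defs
open import Data.Bool using (Bool; true; false; T; not; _∧_)
open import Data.Bool.ListAction using (all; any)
open import Data.Bool.Properties using (T-≡; T-∧)
open import Data.Empty using (⊥-elim)
open import Data.Fin using (Fin)
open import Data.Fin.Subset
  using (∣_∣; Subset; inside; outside; _∈_; _∉_; _⊆_; _∩_; _∪_; ∁; ⋂; ⊥)
open import Data.Fin.Subset.Properties
  using ( ∣p∣≤n; p⊆q⇒∣p∣≤∣q∣; ∉⊥; ∣⊥∣≡0; ⊆-refl; ⊆-antisym; x∈∁p⇒x∉p
        ; p∩q⊆p; p∩q⊆q; x∈p∩q⁺; x∈p∩q⁻; x∈p∪q⁻; ∩-assoc; ∩-identityʳ)
open import Data.List using (List; []; _∷_; allFin; map)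
open import Data.List.Membership.Propositional using (lose) renaming (_∈_ to _∈ˡ_)
open import Data.List.Membership.Propositional.Properties
  using (∈-allFin; ∈-map⁺; ∈-map⁻; ∈-++⁺ˡ; ∈-++⁺ʳ; ∈-filter⁺; ∈-filter⁻; foldr-selective)
open import Data.List.Properties using (foldr-preservesᵒ)
open import Data.List.Relation.Unary.All as All using (All; []; _∷_)
open import Data.List.Relation.Unary.All.Properties using (all⁺; all⁻)
open import Data.List.Relation.Unary.Any using (here; there; satisfied)
open import Data.List.Relation.Unary.Any.Properties using (any⁺; any⁻)
open import Data.Nat using (ℕ; suc; _+_; _*_; _<_; _≤_; _≡ᵇ_)
open import Data.Nat.Properties
  using ( +-suc; +-identityʳ; +-monoʳ-≤; +-cancelʳ-≤; +-cancelʳ-<; ≤-refl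
        ; ⊔-sel; m≤n⇒m≤n⊔o; m≤n⇒m≤o⊔n; ≡⇒≡ᵇ; ≡ᵇ⇒≡; module ≤-Reasoning)
open import Data.Product using (∃; _×_; _,_; proj₁; proj₂)
open import Data.Sum using (inj₁; inj₂; [_,_])
open import Data.Vec using ([]; _∷_; here; there; lookup; tabulate)
open import Data.Vec.Properties
  using ( lookup⇒[]=; []=⇒lookup; lookup∘tabulate; tabulate∘lookup; tabulate-cong
        ; lookup-zipWith; lookup-replicate)
open import Function using (_∘_; Equivalence)
open import Relation.Nullary using (¬_)
open import Relation.Nullary.Decidable using (T?)
open import Relation.Binary.PropositionalEquality using (_≡_; refl; sym; trans; cong; subst)

open Equivalence using (to; from)

private variable
  n : ℕ
  x : Fin n
  p q S X Z : Subset n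
  L : List (Subset n)

T-not⇒¬T : ∀ {b} → T (not b) → ¬ T b
T-not⇒¬T {false} _ ()

¬T⇒T-not : ∀ {b} → ¬ T b → T (not b)
¬T⇒T-not {false} _  = _
¬T⇒T-not {true}  ¬t = ¬t _

∈⇒T-lookup : x ∈ p → T (lookup p x)
∈⇒T-lookup x∈p = from T-≡ ([]=⇒lookup x∈p)

T-lookup⇒∈ : T (lookup p x) → x ∈ p
T-lookup⇒∈ t = lookup⇒[]= _ _ (to T-≡ t)

∈-tabulate⁺ : {f : Fin n → Bool} → T (f x) → x ∈ tabulate f
∈-tabulate⁺ {x = x} {f} t = T-lookup⇒∈ (subst T (sym (lookup∘tabulate f x)) t)

∈-tabulate⁻ : {f : Fin n → Bool} → x ∈ tabulate f → T (f x)
∈-tabulate⁻ {x = x} {f} x∈ = subst T (lookup∘tabulate f x) (∈⇒T-lookup x∈)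

all-allFin⁺ : {f : Fin n → Bool} → (∀ i → T (f i)) → T (all f (allFin n))
all-allFin⁺ {n} {f} h = all⁻ f {xs = allFin n} (All.tabulate (λ {i} _ → h i))

all-allFin⁻ : {f : Fin n → Bool} → T (all f (allFin n)) → ∀ i → T (f i)
all-allFin⁻ {n} {f} t i = All.lookup (all⁺ f (allFin n) t) (∈-allFin i)

Disjoint : Subset n → Subset n → Set
Disjoint p q = ∀ {x} → x ∈ p → x ∉ q

∣p∣≡∣p∩q∣+∣p∩∁q∣ : (p q : Subset n) → ∣ p ∣ ≡ ∣ p ∩ q ∣ + ∣ p ∩ ∁ q ∣
∣p∣≡∣p∩q∣+∣p∩∁q∣ []            []            = refl
∣p∣≡∣p∩q∣+∣p∩∁q∣ (inside  ∷ p) (inside  ∷ q) = cong suc (∣p∣≡∣p∩q∣+∣p∩∁q∣ p q)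
∣p∣≡∣p∩q∣+∣p∩∁q∣ (inside  ∷ p) (outside ∷ q) =
  trans (cong suc (∣p∣≡∣p∩q∣+∣p∩∁q∣ p q)) (sym (+-suc _ _))
∣p∣≡∣p∩q∣+∣p∩∁q∣ (outside ∷ p) (_       ∷ q) = ∣p∣≡∣p∩q∣+∣p∩∁q∣ p q

x∈p∩∁q⇒x∉q : x ∈ p ∩ ∁ q → x ∉ q
x∈p∩∁q⇒x∉q {p = p} {q} x∈ = x∈∁p⇒x∉p (p∩q⊆q p (∁ q) x∈)

disjoint-tail : ∀ {s t} → Disjoint (s ∷ p) (t ∷ q) → Disjoint p q
disjoint-tail d x∈p x∈q = d (there x∈p) (there x∈q)

∣p∪q∣≡∣p∣+∣q∣ : (p q : Subset n) → Disjoint p q → ∣ p ∪ q ∣ ≡ ∣ p ∣ + ∣ q ∣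
∣p∪q∣≡∣p∣+∣q∣ []            []            _ = refl
∣p∪q∣≡∣p∣+∣q∣ (inside  ∷ p) (inside  ∷ q) d = ⊥-elim (d here here)
∣p∪q∣≡∣p∣+∣q∣ (inside  ∷ p) (outside ∷ q) d = cong suc (∣p∪q∣≡∣p∣+∣q∣ p q (disjoint-tail d))
∣p∪q∣≡∣p∣+∣q∣ (outside ∷ p) (inside  ∷ q) d =
  trans (cong suc (∣p∪q∣≡∣p∣+∣q∣ p q (disjoint-tail d))) (sym (+-suc _ _))
∣p∪q∣≡∣p∣+∣q∣ (outside ∷ p) (outside ∷ q) d = ∣p∪q∣≡∣p∣+∣q∣ p q (disjoint-tail d)

∈-allSubsets : (S : Subset n) → S ∈ˡ allSubsets n
∈-allSubsets []            = here refl
∈-allSubsets (inside  ∷ S) = ∈-++⁺ˡ (∈-map⁺ (inside ∷_) (∈-allSubsets S))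
∈-allSubsets (outside ∷ S) = ∈-++⁺ʳ _ (∈-map⁺ (outside ∷_) (∈-allSubsets S))

lookup-⋂ : (L : List (Subset n)) (x : Fin n) → lookup (⋂ L) x ≡ all (λ S → lookup S x) L
lookup-⋂ []      x = lookup-replicate x inside
lookup-⋂ (S ∷ L) x = trans (lookup-zipWith _∧_ x S (⋂ L)) (cong (lookup S x ∧_) (lookup-⋂ L x))

⋂-lowerBound : S ∈ˡ L → ⋂ L ⊆ S
⋂-lowerBound {S = S} {L = _ ∷ L} (here refl) = p∩q⊆p S (⋂ L)
⋂-lowerBound {L = R ∷ L} (there S∈L) x∈ = ⋂-lowerBound S∈L (p∩q⊆q R (⋂ L) x∈)

∩⋂≡⋂ : S ∈ˡ L → S ∩ ⋂ L ≡ ⋂ L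
∩⋂≡⋂ {S = S} {L = L} S∈L =
  ⊆-antisym (p∩q⊆q S (⋂ L)) (λ x∈ → x∈p∩q⁺ (⋂-lowerBound S∈L x∈ , x∈))

module _ (G : Graph n) where

  Stable : Subset n → Set
  Stable S = ∀ {u v} → u ∈ S → v ∈ S → ¬ T (adj G u v)

  IsMaximumStable : Subset n → Set
  IsMaximumStable S = Stable S × ∣ S ∣ ≡ α G

  Deficient : Subset n → Set
  Deficient A = ∣ N G A ∣ < ∣ A ∣

  stable-anti-mono : p ⊆ q → Stable q → Stable p
  stable-anti-mono p⊆q sq u∈ v∈ = sq (p⊆q u∈) (p⊆q v∈)

  isStable⇒Stable : T (isStable G S) → Stable S
  isStable⇒Stable {S} t {u} {v} u∈S v∈S uv =
    T-not⇒¬T no-edge (from T-∧ (∈⇒T-lookup u∈S , from T-∧ (∈⇒T-lookup v∈S , uv)))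
    where
    no-edge : T (not (lookup S u ∧ lookup S v ∧ adj G u v))
    no-edge = all-allFin⁻ (all-allFin⁻ t u) v

  Stable⇒isStable : Stable S → T (isStable G S)
  Stable⇒isStable {S} sS = all-allFin⁺ λ u → all-allFin⁺ λ v → ¬T⇒T-not (no-edge u v)
    where
    no-edge : ∀ u v → ¬ T (lookup S u ∧ lookup S v ∧ adj G u v)
    no-edge u v t with to T-∧ t
    ... | tu , t′ with to T-∧ t′
    ...   | tv , uv = sS (T-lookup⇒∈ tu) (T-lookup⇒∈ tv) uv

  ∈-stableSets⁺ : Stable S → S ∈ˡ stableSets G
  ∈-stableSets⁺ sS =
    ∈-filter⁺ (T? ∘ isStable G) {xs = allSubsets n} (∈-allSubsets _) (Stable⇒isStable sS)

  ∈-stableSets⁻ : S ∈ˡ stableSets G → Stable S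
  ∈-stableSets⁻ S∈ = isStable⇒Stable (proj₂ (∈-filter⁻ (T? ∘ isStable G) {xs = allSubsets n} S∈))

  ∣S∣≤α : Stable S → ∣ S ∣ ≤ α G
  ∣S∣≤α {S} sS =
    foldr-preservesᵒ {P = ∣ S ∣ ≤_} (λ a b → [ m≤n⇒m≤n⊔o b , m≤n⇒m≤o⊔n a ]) 0 _
    (inj₂ (lose (∈-map⁺ ∣_∣ (∈-stableSets⁺ sS)) ≤-refl))

  ∈-Ω⁺ : IsMaximumStable S → S ∈ˡ Ω G
  ∈-Ω⁺ (sS , ∣S∣≡α) =
    ∈-filter⁺ (T? ∘ (λ S → ∣ S ∣ ≡ᵇ α G)) (∈-stableSets⁺ sS) (≡⇒≡ᵇ _ _ ∣S∣≡α)

  ∈-Ω⁻ : S ∈ˡ Ω G → IsMaximumStable S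
  ∈-Ω⁻ S∈ with ∈-filter⁻ (T? ∘ (λ S → ∣ S ∣ ≡ᵇ α G)) {xs = stableSets G} S∈
  ... | S∈stable , t = ∈-stableSets⁻ S∈stable , ≡ᵇ⇒≡ _ _ t

  Ω-nonempty : ∃ (_∈ˡ Ω G)
  Ω-nonempty with foldr-selective ⊔-sel 0 (map ∣_∣ (stableSets G))
  ... | inj₁ α≡0 = ⊥ , ∈-Ω⁺ ((λ u∈⊥ _ _ → ∉⊥ u∈⊥) , trans (∣⊥∣≡0 n) (sym α≡0))
  ... | inj₂ α∈  with ∈-map⁻ ∣_∣ α∈
  ...   | S , S∈ , α≡∣S∣ = S , ∈-Ω⁺ (∈-stableSets⁻ S∈ , sym α≡∣S∣)

  core≡⋂Ω : core G ≡ ⋂ (Ω G)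
  core≡⋂Ω = trans (tabulate-cong (sym ∘ lookup-⋂ (Ω G))) (tabulate∘lookup (⋂ (Ω G)))

  ∈-N⁺ : ∀ {A u v} → u ∈ A → T (adj G u v) → v ∈ N G A
  ∈-N⁺ {u = u} u∈A uv =
    ∈-tabulate⁺ (any⁺ _ (lose (∈-allFin u) (from T-∧ (∈⇒T-lookup u∈A , uv))))

  ∈-N⁻ : ∀ {A v} → v ∈ N G A → ∃ λ u → u ∈ A × T (adj G u v)
  ∈-N⁻ {A} {v} v∈NA
    with satisfied (any⁻ (λ u → lookup A u ∧ adj G u v) (allFin n) (∈-tabulate⁻ v∈NA))
  ... | u , t = u , T-lookup⇒∈ (proj₁ (to T-∧ t)) , proj₂ (to T-∧ t)

  N-mono : p ⊆ q → N G p ⊆ N G q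
  N-mono p⊆q v∈Np with ∈-N⁻ v∈Np
  ... | u , u∈p , uv = ∈-N⁺ (p⊆q u∈p) uv

  N-disjoint-stable : Stable S → p ⊆ S → Disjoint (N G p) S
  N-disjoint-stable sS p⊆S v∈Np v∈S with ∈-N⁻ v∈Np
  ... | u , u∈p , uv = sS (p⊆S u∈p) v∈S uv

  stable-∪-∖N : Stable Z → Stable S → Stable (Z ∪ (S ∩ ∁ (N G Z)))
  stable-∪-∖N {Z} {S} sZ sS {u} {v} u∈ v∈ uv with x∈p∪q⁻ Z _ u∈ | x∈p∪q⁻ Z _ v∈
  ... | inj₁ u∈Z | inj₁ v∈Z = sZ u∈Z v∈Z uv
  ... | inj₁ u∈Z | inj₂ v∈S∖NZ = x∈p∩∁q⇒x∉q v∈S∖NZ (∈-N⁺ u∈Z uv)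
  ... | inj₂ u∈S∖NZ | inj₁ v∈Z = x∈p∩∁q⇒x∉q u∈S∖NZ (∈-N⁺ v∈Z (subst T (adj-sym G u v) uv))
  ... | inj₂ u∈S∖NZ | inj₂ v∈S∖NZ = sS (p∩q⊆p S _ u∈S∖NZ) (p∩q⊆p S _ v∈S∖NZ) uv

  maximumStable-deficient : n < 2 * α G → IsMaximumStable S → Deficient S
  maximumStable-deficient {S} n<2α (sS , ∣S∣≡α) = +-cancelʳ-< ∣ S ∣ _ _ (begin-strict
    ∣ N G S ∣ + ∣ S ∣      ≡⟨ ∣p∪q∣≡∣p∣+∣q∣ (N G S) S (N-disjoint-stable sS ⊆-refl) ⟨
    ∣ N G S ∪ S ∣          ≤⟨ ∣p∣≤n (N G S ∪ S) ⟩
    n                      <⟨ n<2α ⟩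
    2 * α G                ≡⟨ cong (2 *_) ∣S∣≡α ⟨
    2 * ∣ S ∣              ≡⟨ cong (∣ S ∣ +_) (+-identityʳ ∣ S ∣) ⟩
    ∣ S ∣ + ∣ S ∣          ∎)
    where open ≤-Reasoning

  ∣Z∣≤∣S∩NZ∣ : IsMaximumStable S → Stable Z → Disjoint Z S → ∣ Z ∣ ≤ ∣ S ∩ N G Z ∣
  ∣Z∣≤∣S∩NZ∣ {S} {Z} (sS , ∣S∣≡α) sZ Z#S = +-cancelʳ-≤ ∣ S ∩ ∁ (N G Z) ∣ _ _ (begin
    ∣ Z ∣ + ∣ S ∩ ∁ (N G Z) ∣              ≡⟨ ∣p∪q∣≡∣p∣+∣q∣ Z _ (λ x∈Z → Z#S x∈Z ∘ p∩q⊆p S _) ⟨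
    ∣ Z ∪ (S ∩ ∁ (N G Z)) ∣                ≤⟨ ∣S∣≤α (stable-∪-∖N sZ sS) ⟩
    α G                                    ≡⟨ ∣S∣≡α ⟨
    ∣ S ∣                                  ≡⟨ ∣p∣≡∣p∩q∣+∣p∩∁q∣ S (N G Z) ⟩
    ∣ S ∩ N G Z ∣ + ∣ S ∩ ∁ (N G Z) ∣      ∎)
    where open ≤-Reasoning

  deficient-∩-maximumStable : Stable X → IsMaximumStable S → Deficient X → Deficient (X ∩ S)
  deficient-∩-maximumStable {X} {S} sX maxS@(sS , _) defX =
    +-cancelʳ-< ∣ X ∩ ∁ S ∣ _ _ (begin-strict
    ∣ N G (X ∩ S) ∣ + ∣ X ∩ ∁ S ∣              ≤⟨ +-monoʳ-≤ ∣ N G (X ∩ S) ∣ ∣X∖S∣≤∣S∩N[X∖S]∣ ⟩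
    ∣ N G (X ∩ S) ∣ + ∣ S ∩ N G (X ∩ ∁ S) ∣    ≡⟨ ∣p∪q∣≡∣p∣+∣q∣ _ _ N[X∩S]#S∩N[X∖S] ⟨
    ∣ N G (X ∩ S) ∪ (S ∩ N G (X ∩ ∁ S)) ∣      ≤⟨ p⊆q⇒∣p∣≤∣q∣ ⊆N[X] ⟩
    ∣ N G X ∣                                  <⟨ defX ⟩
    ∣ X ∣                                      ≡⟨ ∣p∣≡∣p∩q∣+∣p∩∁q∣ X S ⟩
    ∣ X ∩ S ∣ + ∣ X ∩ ∁ S ∣                    ∎)
    where
    open ≤-Reasoning
    ∣X∖S∣≤∣S∩N[X∖S]∣ : ∣ X ∩ ∁ S ∣ ≤ ∣ S ∩ N G (X ∩ ∁ S) ∣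
    ∣X∖S∣≤∣S∩N[X∖S]∣ = ∣Z∣≤∣S∩NZ∣ maxS (stable-anti-mono (p∩q⊆p X _) sX) x∈p∩∁q⇒x∉q
    N[X∩S]#S∩N[X∖S] : Disjoint (N G (X ∩ S)) (S ∩ N G (X ∩ ∁ S))
    N[X∩S]#S∩N[X∖S] x∈N = N-disjoint-stable sS (p∩q⊆q X S) x∈N ∘ p∩q⊆p S _
    ⊆N[X] : N G (X ∩ S) ∪ (S ∩ N G (X ∩ ∁ S)) ⊆ N G X
    ⊆N[X] x∈ with x∈p∪q⁻ (N G (X ∩ S)) _ x∈
    ... | inj₁ x∈N[X∩S]   = N-mono (p∩q⊆p X S) x∈N[X∩S]
    ... | inj₂ x∈S∩N[X∖S] = N-mono (p∩q⊆p X _) (p∩q⊆q S _ x∈S∩N[X∖S])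

  deficient-∩-⋂ : Stable X → All IsMaximumStable L → Deficient X → Deficient (X ∩ ⋂ L)
  deficient-∩-⋂ {X} sX [] defX = subst Deficient (sym (∩-identityʳ X)) defX
  deficient-∩-⋂ {X} {S ∷ L} sX (maxS ∷ maxL) defX =
    subst Deficient (∩-assoc X S (⋂ L))
      (deficient-∩-⋂ {X ∩ S} (stable-anti-mono (p∩q⊆p X S) sX) maxL
        (deficient-∩-maximumStable sX maxS defX))

theorem5 : ∀ {n : ℕ} (G : Graph n) → n < 2 * α G → ∣ N G (core G) ∣ < ∣ core G ∣
theorem5 G n<2α with Ω-nonempty G
... | S , S∈Ω = subst (Deficient G) S∩⋂Ω≡core deficient-S∩⋂Ω
  where
  maxS : IsMaximumStable G S
  maxS = ∈-Ω⁻ G S∈Ω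
  deficient-S∩⋂Ω : Deficient G (S ∩ ⋂ (Ω G))
  deficient-S∩⋂Ω =
    deficient-∩-⋂ G (proj₁ maxS) (All.tabulate (∈-Ω⁻ G)) (maximumStable-deficient G n<2α maxS)
  S∩⋂Ω≡core : S ∩ ⋂ (Ω G) ≡ core G
  S∩⋂Ω≡core = trans (∩⋂≡⋂ S∈Ω) (sym (core≡⋂Ω G))
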